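{- Let $m\ge1$ and let $W_n^{(m)}(1-11,1-12)$ be the set of words of length $n$ on $\{1,\dots,m\}$ that avoid both generalized patterns $1-11$ and $1-12$. Then \[ \sum_{n\ge0}|W_n^{(m)}(1-11,1-12)|\,x^n=\sum_{k=0}^{m}\binom{m}{k}(1+x)^k\,C_k(x), \] where $C_0(x)=1$ and, for $k\ge1$, $C_k(x)=\sum_{n\ge0}c_{n,k}x^n$ with $c_{n,k}$ the number of words of length $n$ on $\{1,\dots,k\}$ in which every letter of $\{1,\dots,k\}$ occurs, which avoid $1-11$ and $1-12$, and whose last letter occurs nowhere else in the word.
   Context: Words are finite sequences $w_1\cdots w_n$ over a totally ordered alphabet. A word $w$ contains the generalized pattern $1-11$ iff there exist indices $1\le i<j<n$ with $w_i=w_j=w_{j+1}$, and contains $1-12$ iff there exist $i<j<n$ with $w_i=w_j<w_{j+1}$; it avoids a pattern if it does not contain it. -}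

module Defs where

open import Data.Nat using (ℕ; zero; suc; _+_; _*_; _∸_; _≤_)
open import Data.Nat.Combinatorics using (_C_)
open import Data.Fin as F using (Fin; toℕ)
open import Data.Fin.Properties using (any?; all?) renaming (_≟_ to _≟ᶠ_; _<?_ to _<ᶠ?_)
import Data.Nat.Properties as ℕP
open import Data.List using (List; []; _∷_; [_]; concatMap; map; filter; length; upTo; allFin)
open import Data.Nat.ListAction using (sum)
open import Data.Vec.Functional using () renaming (_∷_ to _◂_)
open import Data.Product using (∃; _×_; _,_)
open import Relation.Binary.PropositionalEquality using (_≡_; _≢_)
open import Relation.Nullary using (Dec; ¬_; ¬?)
open import Relation.Nullary.Decidable using (_×-dec_)
open import Relation.Unary using (Decidable)

-- A word of length n over the alphabet {1,…,m}, encoded as Fin m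
-- (letter a+1 ↦ a : Fin m; order preserved), positions indexed by Fin n.
Word : ℕ → ℕ → Set
Word m n = Fin n → Fin m

Contains1-11 : ∀ {m n} → Word m n → Set
Contains1-11 {m} {n} w =
  ∃ λ (i : Fin n) → ∃ λ (j : Fin n) → ∃ λ (k : Fin n) →
    (i F.< j) × (toℕ k ≡ suc (toℕ j)) × (w i ≡ w j) × (w j ≡ w k)

Contains1-12 : ∀ {m n} → Word m n → Set
Contains1-12 {m} {n} w =
  ∃ λ (i : Fin n) → ∃ λ (j : Fin n) → ∃ λ (k : Fin n) →
    (i F.< j) × (toℕ k ≡ suc (toℕ j)) × (w i ≡ w j) × (w j F.< w k)

AvoidsBoth : ∀ {m n} → Word m n → Set
AvoidsBoth w = ¬ Contains1-11 w × ¬ Contains1-12 w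

AllLettersOccur : ∀ {m n} → Word m n → Set
AllLettersOccur {m} {n} w = (a : Fin m) → ∃ λ (i : Fin n) → w i ≡ a

LastLetterUnique : ∀ {m n} → Word m n → Set
LastLetterUnique {m} {n} w =
  ∃ λ (l : Fin n) → (suc (toℕ l) ≡ n) × ((i : Fin n) → i ≢ l → w i ≢ w l)

CountedByC : ∀ {m n} → Word m n → Set
CountedByC w = AllLettersOccur w × AvoidsBoth w × LastLetterUnique w

contains1-11? : ∀ {m n} → Decidable (Contains1-11 {m} {n})
contains1-11? w = any? λ i → any? λ j → any? λ k →
  (i <ᶠ? j) ×-dec ((toℕ k ℕP.≟ suc (toℕ j)) ×-dec ((w i ≟ᶠ w j) ×-dec (w j ≟ᶠ w k)))

contains1-12? : ∀ {m n} → Decidable (Contains1-12 {m} {n})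
contains1-12? w = any? λ i → any? λ j → any? λ k →
  (i <ᶠ? j) ×-dec ((toℕ k ℕP.≟ suc (toℕ j)) ×-dec ((w i ≟ᶠ w j) ×-dec (w j <ᶠ? w k)))

avoidsBoth? : ∀ {m n} → Decidable (AvoidsBoth {m} {n})
avoidsBoth? w = ¬? (contains1-11? w) ×-dec ¬? (contains1-12? w)

allLettersOccur? : ∀ {m n} → Decidable (AllLettersOccur {m} {n})
allLettersOccur? w = all? λ a → any? λ i → w i ≟ᶠ a

lastLetterUnique? : ∀ {m n} → Decidable (LastLetterUnique {m} {n})
lastLetterUnique? {n = n} w = any? λ l → (suc (toℕ l) ℕP.≟ n) ×-dec
  (all? λ i → (¬? (i ≟ᶠ l)) →-dec' (¬? (w i ≟ᶠ w l)))
  where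
  _→-dec'_ : ∀ {A B : Set} → Dec A → Dec B → Dec (A → B)
  _→-dec'_ = Relation.Nullary.Decidable._→-dec_
    where import Relation.Nullary.Decidable

countedByC? : ∀ {m n} → Decidable (CountedByC {m} {n})
countedByC? w = allLettersOccur? w ×-dec (avoidsBoth? w ×-dec lastLetterUnique? w)

allWords : (m n : ℕ) → List (Word m n)
allWords m zero = [ (λ ()) ]
allWords m (suc n) = concatMap (λ a → map (λ w → a ◂ w) (allWords m n)) (allFin m)

W : ℕ → ℕ → ℕ
W m n = length (filter avoidsBoth? (allWords m n))

c : ℕ → ℕ → ℕ
c n k = length (filter countedByC? (allWords k n))

Series : Set
Series = ℕ → ℕ

_⊛_ : Series → Series → Series
(f ⊛ g) n = sum (map (λ i → f i * g (n ∸ i)) (upTo (suc n)))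

oneS : Series
oneS zero = 1
oneS (suc _) = 0

onePlusX : Series
onePlusX zero = 1
onePlusX (suc zero) = 1
onePlusX (suc (suc _)) = 0

_^ˢ_ : Series → ℕ → Series
f ^ˢ zero = oneS
f ^ˢ suc k = f ⊛ (f ^ˢ k)

Cser : ℕ → Series
Cser zero = oneS
Cser (suc k) n = c n (suc k)

Wser : ℕ → Series
Wser m n = W m n

RHS : ℕ → Series
RHS m n = sum (map (λ k → (m C k) * ((onePlusX ^ˢ k) ⊛ Cser k) n) (upTo (suc m)))

module Submission where

-- Let U(m, j) count the avoiding words over m letters in which every
--     letter below j occurs.  Splitting on whether the letter j occurs, and relabelling the
--     words omitting j by punchIn j (injective and monotone, so it preserves both patterns),
--     gives U(m+1, j) = U(m+1, j+1) + U(m, j).  Hence W_m = U(m, 0) = ∑_k C(m,k) Onto(k), where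
--     Onto(k) = U(k, k) counts the avoiding words in which all k letters occur.
-- (2) Removing the last letter.  An occurrence of 1-1ρ in u·x lies in u, or ends at x, which
--     happens iff the last letter y of u is repeated in u and y ρ x.  Let V(k, j) count the
--     avoiding words using all k letters whose last letter is new or at least j.  The words
--     counted by V(k, j) but not by V(k, j+1) are exactly the words u·j with u counted by
--     V(k, j+1), so V(k, j) = (1 + x) V(k, j+1) as series.  As V(k, 0) = Onto(k) and
--     V(k, k) = C_k, this gives Onto(k) = (1 + x)^k C_k.

open import Defs
open import Data.Nat.Combinatorics using (_C_; nCk+nC[k+1]≡[n+1]C[k+1]; k>n⇒nCk≡0)
open import Data.Nat using (ℕ; zero; suc; _+_; _*_; _∸_; _≤_; _<_; z≤n; s≤s; s≤s⁻¹)
import Data.Nat.Properties as ℕP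
open import Data.Fin as F using (Fin; toℕ; punchIn; inject₁; fromℕ)
import Data.Fin.Properties as FP
open import Data.List using (List; []; _∷_; _++_; map; filter; length; tabulate; concatMap; upTo; applyUpTo)
open import Data.List.Properties using (length-++; filter-++; filter-≐; map-upTo)
import Data.Nat.ListAction as List
open import Data.Vec.Functional using (removeAt; init; last) renaming (_∷_ to _◂_)
open import Data.Product using (∃; _×_; _,_; proj₁; proj₂)
open import Data.Empty using (⊥; ⊥-elim)
open import Data.Sum using (_⊎_; inj₁; inj₂; [_,_]′)
open import Data.Unit using (⊤; tt)
open import Function using (_∘_; _⇔_; mk⇔; Equivalence)
open import Relation.Binary.PropositionalEquality
open import Relation.Nullary using (yes; no; ¬_; ¬?; does)
open import Relation.Nullary.Decidable using (_×-dec_; _→-dec_; decidable-stable)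
open import Relation.Unary using (Decidable; _≐_)
open import Data.Bool using (true; false)
open import Algebra.Properties.CommutativeMonoid.Sum ℕP.+-0-commutativeMonoid
  using (sum; sum-syntax; sum-cong-≗; sum-remove; sum-replicate-zero; sum-init-last; ∑-distrib-+)

sum-zero : ∀ {n} (f : Fin n → ℕ) → (∀ i → f i ≡ 0) → sum f ≡ 0
sum-zero {n} f f≡0 = trans (sum-cong-≗ f≡0) (sum-replicate-zero n)

sum-single : ∀ {m} (j : Fin m) (f : Fin m → ℕ) → (∀ a → a ≢ j → f a ≡ 0) → sum f ≡ f j
sum-single {suc m} j f f≡0 = begin
  sum f                      ≡⟨ sum-remove {i = j} f ⟩
  f j + sum (removeAt f j)   ≡⟨ cong (f j +_) (sum-zero _ (λ b → f≡0 _ (FP.punchInᵢ≢i j b))) ⟩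
  f j + 0                    ≡⟨ ℕP.+-identityʳ (f j) ⟩
  f j                        ∎
  where open ≡-Reasoning

sum-upTo : ∀ (f : ℕ → ℕ) n → List.sum (map f (upTo n)) ≡ ∑[ i < n ] f (toℕ i)
sum-upTo f n = trans (cong List.sum (map-upTo f n)) (sum-applyUpTo f n)
  where
  sum-applyUpTo : ∀ (f : ℕ → ℕ) n → List.sum (applyUpTo f n) ≡ ∑[ i < n ] f (toℕ i)
  sum-applyUpTo f zero    = refl
  sum-applyUpTo f (suc n) = cong (f 0 +_) (sum-applyUpTo (f ∘ suc) n)

sum-last : ∀ (f : ℕ → ℕ) n → ∑[ i < suc n ] f (toℕ i) ≡ ∑[ i < n ] f (toℕ i) + f n
sum-last f n = begin
  ∑[ i < suc n ] f (toℕ i)                          ≡⟨ sum-init-last (f ∘ toℕ) ⟩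
  ∑[ i < n ] f (toℕ (inject₁ i)) + f (toℕ (fromℕ n)) ≡⟨ cong₂ _+_ (sum-cong-≗ {n} (cong f ∘ FP.toℕ-inject₁))
                                                                   (cong f (FP.toℕ-fromℕ n)) ⟩
  ∑[ i < n ] f (toℕ i) + f n                         ∎
  where open ≡-Reasoning

-- Number of elements of a list satisfying a decidable predicate.  The definition
-- is kept opaque so that counts are compared through the lemmas below rather than
-- by unfolding filter.
opaque
  count : ∀ {A : Set} {P : A → Set} → Decidable P → List A → ℕ
  count P? xs = length (filter P? xs)

  count-cong : ∀ {A : Set} {P Q : A → Set} (P? : Decidable P) (Q? : Decidable Q) →
               P ≐ Q → ∀ xs → count P? xs ≡ count Q? xs
  count-cong P? Q? P≐Q xs = cong length (filter-≐ P? Q? P≐Q xs)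

  count-++ : ∀ {A : Set} {P : A → Set} (P? : Decidable P) xs ys →
             count P? (xs ++ ys) ≡ count P? xs + count P? ys
  count-++ P? xs ys = trans (cong length (filter-++ P? xs ys)) (length-++ (filter P? xs))

  count-map : ∀ {A B : Set} {P : B → Set} (P? : Decidable P) (g : A → B) xs →
              count P? (map g xs) ≡ count (P? ∘ g) xs
  count-map P? g []       = refl
  count-map P? g (x ∷ xs) with does (P? (g x))
  ... | true  = cong suc (count-map P? g xs)
  ... | false = count-map P? g xs

  count-split : ∀ {A : Set} {P Q : A → Set} (P? : Decidable P) (Q? : Decidable Q) xs →
                count P? xs ≡ count (λ x → P? x ×-dec Q? x) xs + count (λ x → P? x ×-dec ¬? (Q? x)) xs
  count-split P? Q? [] = refl
  count-split P? Q? (x ∷ xs) with P? x | Q? x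
  ... | yes _ | yes _ = cong suc (count-split P? Q? xs)
  ... | yes _ | no  _ = trans (cong suc (count-split P? Q? xs)) (sym (ℕP.+-suc _ _))
  ... | no  _ | yes _ = count-split P? Q? xs
  ... | no  _ | no  _ = count-split P? Q? xs

  count-none : ∀ {A : Set} {P : A → Set} (P? : Decidable P) xs → (∀ x → ¬ P x) → count P? xs ≡ 0
  count-none P? []       ¬P = refl
  count-none P? (x ∷ xs) ¬P with P? x
  ... | yes p = ⊥-elim (¬P x p)
  ... | no  _ = count-none P? xs ¬P

  count-concatMap : ∀ {A B : Set} {P : B → Set} (P? : Decidable P) {m} (g : Fin m → A) (h : A → List B) →
                    count P? (concatMap h (tabulate g)) ≡ ∑[ a < m ] count P? (h (g a))
  count-concatMap P? {zero}  g h = refl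
  count-concatMap P? {suc m} g h = trans (count-++ P? (h (g F.zero)) _)
    (cong (count P? (h (g F.zero)) +_) (count-concatMap P? (g ∘ F.suc) h))

  count-singleton : ∀ {A B : Set} {P : A → Set} {Q : B → Set} (P? : Decidable P) (Q? : Decidable Q) {x y} →
                    (P x → Q y) → (Q y → P x) → count P? (x ∷ []) ≡ count Q? (y ∷ [])
  count-singleton P? Q? {x} {y} P⇒Q Q⇒P with P? x | Q? y
  ... | yes _ | yes _ = refl
  ... | yes p | no ¬q = ⊥-elim (¬q (P⇒Q p))
  ... | no ¬p | yes q = ⊥-elim (¬p (Q⇒P q))
  ... | no  _ | no  _ = refl

  count-filter : ∀ {A : Set} {P : A → Set} (P? : Decidable P) xs → count P? xs ≡ length (filter P? xs)
  count-filter P? xs = refl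

#words : ∀ m n {P : Word m n → Set} → Decidable P → ℕ
#words m n P? = count P? (allWords m n)

-- A property of words is invariant if it only depends on the letters of the word
-- (words are functions, so pointwise equal words need not be equal).
Invariant : ∀ {m n} → (Word m n → Set) → Set
Invariant {m} {n} P = ∀ {w w' : Word m n} → w ≗ w' → P w → P w'

◂-cong : ∀ {m n} (a : Fin m) {v v' : Word m n} → v ≗ v' → (a ◂ v) ≗ (a ◂ v')
◂-cong a v≗v' F.zero    = refl
◂-cong a v≗v' (F.suc i) = v≗v' i

#words-cons : ∀ m n {P : Word m (suc n) → Set} (P? : Decidable P) →
              #words m (suc n) P? ≡ ∑[ a < m ] #words m n (λ w → P? (a ◂ w))
#words-cons m n P? = trans (count-concatMap P? (λ a → a) (λ a → map (a ◂_) (allWords m n)))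
  (sum-cong-≗ (λ a → count-map P? (a ◂_) (allWords m n)))

#words-snoc : ∀ m n {R : Word m n → Set} (R? : Decidable R) → Invariant R → (j : Fin m) →
              #words m (suc n) (λ w → (last w F.≟ j) ×-dec R? (init w)) ≡ #words m n R?
#words-snoc m zero {R} R? inv j = begin
  #words m 1 (λ w → (last w F.≟ j) ×-dec R? (init w))
    ≡⟨ #words-cons m 0 _ ⟩
  ∑[ a < m ] #words m 0 (λ w → (a F.≟ j) ×-dec R? (init (a ◂ w)))
    ≡⟨ sum-single j _ (λ a a≢j → count-none _ (allWords m 0) (λ _ p → a≢j (proj₁ p))) ⟩
  #words m 0 (λ w → (j F.≟ j) ×-dec R? (init (j ◂ w)))
    ≡⟨ count-singleton _ R? (λ p → inv (λ ()) (proj₂ p)) (λ r → refl , inv (λ ()) r) ⟩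
  #words m 0 R?
    ∎
  where open ≡-Reasoning
#words-snoc m (suc n) {R} R? inv j = begin
  #words m (suc (suc n)) (λ w → (last w F.≟ j) ×-dec R? (init w))
    ≡⟨ #words-cons m (suc n) _ ⟩
  ∑[ a < m ] #words m (suc n) (λ w → (last w F.≟ j) ×-dec R? (init (a ◂ w)))
    ≡⟨ sum-cong-≗ (λ a → count-cong _ _ (init-cons a) (allWords m (suc n))) ⟩
  ∑[ a < m ] #words m (suc n) (λ w → (last w F.≟ j) ×-dec R? (a ◂ init w))
    ≡⟨ sum-cong-≗ (λ a → #words-snoc m n (R? ∘ (a ◂_)) (inv ∘ ◂-cong a) j) ⟩
  ∑[ a < m ] #words m n (λ w → R? (a ◂ w))
    ≡⟨ #words-cons m n R? ⟨
  #words m (suc n) R?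
    ∎
  where
  open ≡-Reasoning
  init-cons-≗ : ∀ (a : Fin m) (w : Word m (suc n)) → init (a ◂ w) ≗ (a ◂ init w)
  init-cons-≗ a w F.zero    = refl
  init-cons-≗ a w (F.suc i) = refl
  init-cons : ∀ a → (λ w → last w ≡ j × R (init (a ◂ w))) ≐ (λ w → last w ≡ j × R (a ◂ init w))
  init-cons a = (λ (p , r) → p , inv (init-cons-≗ a _) r) , (λ (p , r) → p , inv (sym ∘ init-cons-≗ a _) r)

Omits : ∀ {m n} → Fin m → Word m n → Set
Omits j w = ∀ i → w i ≢ j

omits? : ∀ {m n} (j : Fin m) → Decidable (Omits {m} {n} j)
omits? j w = FP.all? (λ i → ¬? (w i F.≟ j))

#words-omitting : ∀ m n (j : Fin (suc m)) {R : Word (suc m) n → Set} (R? : Decidable R) → Invariant R →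
                  #words (suc m) n (λ w → omits? j w ×-dec R? w) ≡ #words m n (λ v → R? (punchIn j ∘ v))
#words-omitting m zero j R? inv =
  count-singleton (λ w → omits? j w ×-dec R? w) (λ v → R? (punchIn j ∘ v))
                  (λ p → inv (λ ()) (proj₂ p)) (λ r → (λ ()) , inv (λ ()) r)
#words-omitting m (suc n) j {R} R? inv = begin
  #words (suc m) (suc n) (λ w → omits? j w ×-dec R? w)
    ≡⟨ #words-cons (suc m) n _ ⟩
  ∑[ a < suc m ] #words (suc m) n (λ w → omits? j (a ◂ w) ×-dec R? (a ◂ w))
    ≡⟨ sum-remove {i = j} (λ a → #words (suc m) n (λ w → omits? j (a ◂ w) ×-dec R? (a ◂ w))) ⟩
  #words (suc m) n (λ w → omits? j (j ◂ w) ×-dec R? (j ◂ w))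
    + ∑[ b < m ] #words (suc m) n (λ w → omits? j (punchIn j b ◂ w) ×-dec R? (punchIn j b ◂ w))
    ≡⟨ cong₂ _+_ (count-none _ _ (λ w p → proj₁ p F.zero refl))
                 (sum-cong-≗ (λ b → count-cong _ _ (omits-cons b) _)) ⟩
  0 + ∑[ b < m ] #words (suc m) n (λ w → omits? j w ×-dec R? (punchIn j b ◂ w))
    ≡⟨ sum-cong-≗ (λ b → #words-omitting m n j (R? ∘ (punchIn j b ◂_)) (inv ∘ ◂-cong (punchIn j b))) ⟩
  ∑[ b < m ] #words m n (λ v → R? (punchIn j b ◂ (punchIn j ∘ v)))
    ≡⟨ sum-cong-≗ (λ b → count-cong _ _ (punchIn-cons b) _) ⟩
  ∑[ b < m ] #words m n (λ v → R? (punchIn j ∘ (b ◂ v)))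
    ≡⟨ #words-cons m n (λ v → R? (punchIn j ∘ v)) ⟨
  #words m (suc n) (λ v → R? (punchIn j ∘ v))
    ∎
  where
  open ≡-Reasoning
  omits-cons : ∀ b → (λ w → Omits j (punchIn j b ◂ w) × R (punchIn j b ◂ w))
                   ≐ (λ w → Omits j w × R (punchIn j b ◂ w))
  omits-cons b = (λ (o , r) → o ∘ F.suc , r)
               , (λ (o , r) → (λ { F.zero → FP.punchInᵢ≢i j b ; (F.suc i) → o i }) , r)
  punchIn-◂ : ∀ b (v : Word m n) → (punchIn j b ◂ (punchIn j ∘ v)) ≗ (punchIn j ∘ (b ◂ v))
  punchIn-◂ b v F.zero    = refl
  punchIn-◂ b v (F.suc i) = refl
  punchIn-cons : ∀ b → (λ v → R (punchIn j b ◂ (punchIn j ∘ v))) ≐ (λ v → R (punchIn j ∘ (b ◂ v)))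
  punchIn-cons b = inv (punchIn-◂ b _) , inv (sym ∘ punchIn-◂ b _)

-- w contains the pattern 1-1ρ: positions i < j with w i = w j and w j ρ w (j+1).
-- Contains1-11 and Contains1-12 are by definition the instances ρ = _≡_ and ρ = _<_.
Pattern : ∀ {m n} → (Fin m → Fin m → Set) → Word m n → Set
Pattern {m} {n} R w = ∃ λ (i : Fin n) → ∃ λ (j : Fin n) → ∃ λ (k : Fin n) →
  (i F.< j) × (toℕ k ≡ suc (toℕ j)) × (w i ≡ w j) × R (w j) (w k)

pattern-≗ : ∀ {m n} (R : Fin m → Fin m → Set) {w w' : Word m n} → w ≗ w' → Pattern R w → Pattern R w'
pattern-≗ R w≗w' (i , j , k , i<j , k≡1+j , wi≡wj , Rjk) =
  i , j , k , i<j , k≡1+j , trans (sym (w≗w' i)) (trans wi≡wj (w≗w' j)) , subst₂ R (w≗w' j) (w≗w' k) Rjk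

pattern-map : ∀ {m m' n} (R : Fin m → Fin m → Set) (R' : Fin m' → Fin m' → Set) (f : Fin m → Fin m') →
              (∀ {a b} → R a b → R' (f a) (f b)) → {w : Word m n} → Pattern R w → Pattern R' (f ∘ w)
pattern-map R R' f pres (i , j , k , i<j , k≡1+j , wi≡wj , Rjk) = i , j , k , i<j , k≡1+j , cong f wi≡wj , pres Rjk

pattern-unmap : ∀ {m m' n} (R : Fin m → Fin m → Set) (R' : Fin m' → Fin m' → Set) (f : Fin m → Fin m') →
                (∀ {a b} → f a ≡ f b → a ≡ b) → (∀ {a b} → R' (f a) (f b) → R a b) →
                {w : Word m n} → Pattern R' (f ∘ w) → Pattern R w
pattern-unmap R R' f inj refl' (i , j , k , i<j , k≡1+j , wi≡wj , Rjk) = i , j , k , i<j , k≡1+j , inj wi≡wj , refl' Rjk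

avoidsBoth-≗ : ∀ {m n} → Invariant (AvoidsBoth {m} {n})
avoidsBoth-≗ w≗w' (no11 , no12) = no11 ∘ pattern-≗ _≡_ (sym ∘ w≗w') , no12 ∘ pattern-≗ F._<_ (sym ∘ w≗w')

-- punchIn j is injective and strictly monotone, so it neither creates nor destroys patterns.
avoidsBoth-punchIn : ∀ {m n} (j : Fin (suc m)) (v : Word m n) → AvoidsBoth (punchIn j ∘ v) ⇔ AvoidsBoth v
avoidsBoth-punchIn j v = mk⇔
  (λ (no11 , no12) → no11 ∘ pattern-map _≡_ _≡_ (punchIn j) (cong (punchIn j)) ,
                     no12 ∘ pattern-map F._<_ F._<_ (punchIn j) (punchIn-mono-< _ _))
  (λ (no11 , no12) → no11 ∘ pattern-unmap _≡_ _≡_ (punchIn j) injective injective ,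
                     no12 ∘ pattern-unmap F._<_ F._<_ (punchIn j) injective (punchIn-cancel-< _ _))
  where
  injective : ∀ {a b} → punchIn j a ≡ punchIn j b → a ≡ b
  injective = FP.punchIn-injective j _ _
  punchIn-mono-< : ∀ a b → a F.< b → punchIn j a F.< punchIn j b
  punchIn-mono-< a b a<b = FP.≤∧≢⇒< (FP.punchIn-mono-≤ j a b (ℕP.<⇒≤ a<b))
                                    (FP.<⇒≢ a<b ∘ FP.punchIn-injective j a b)
  punchIn-cancel-< : ∀ a b → punchIn j a F.< punchIn j b → a F.< b
  punchIn-cancel-< a b lt = FP.≤∧≢⇒< (FP.punchIn-cancel-≤ j a b (ℕP.<⇒≤ lt)) (FP.<⇒≢ lt ∘ cong (punchIn j))

LastRepeated : ∀ {m n} → Word m (suc n) → Set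
LastRepeated {n = n} u = ∃ λ (i : Fin n) → u (inject₁ i) ≡ last u

lastRepeated? : ∀ {m n} → Decidable (LastRepeated {m} {n})
lastRepeated? u = FP.any? (λ i → u (inject₁ i) F.≟ last u)

inject₁-below : ∀ {n} (i : Fin (suc n)) → toℕ i < n → ∃ λ (i' : Fin n) → inject₁ i' ≡ i
inject₁-below i i<n = F.lower₁ i n≢i , FP.inject₁-lower₁ i n≢i
  where n≢i = λ n≡i → ℕP.<-irrefl (sym n≡i) i<n

toℕ-below : ∀ {n} {i : Fin (suc n)} (i′ : ∃ λ (i' : Fin n) → inject₁ i' ≡ i) → toℕ (proj₁ i′) ≡ toℕ i
toℕ-below (i' , refl) = sym (FP.toℕ-inject₁ i')

position-view : ∀ {n} (i : Fin (suc n)) → (∃ λ i' → inject₁ i' ≡ i) ⊎ i ≡ fromℕ n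
position-view {n} i with toℕ i ℕP.<? n
... | yes i<n = inj₁ (inject₁-below i i<n)
... | no  i≮n = inj₂ (FP.toℕ-injective (trans (ℕP.≤-antisym (s≤s⁻¹ (FP.toℕ<n i)) (ℕP.≮⇒≥ i≮n))
                                             (sym (FP.toℕ-fromℕ n))))

pattern-init : ∀ {m n} (R : Fin m → Fin m → Set) (w : Word m (suc n)) → Pattern R (init w) → Pattern R w
pattern-init R w (i , j , k , i<j , k≡1+j , wi≡wj , Rjk) =
  inject₁ i , inject₁ j , inject₁ k ,
  subst₂ _<_ (sym (FP.toℕ-inject₁ i)) (sym (FP.toℕ-inject₁ j)) i<j ,
  trans (FP.toℕ-inject₁ k) (trans k≡1+j (cong suc (sym (FP.toℕ-inject₁ j)))) , wi≡wj , Rjk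

pattern-last : ∀ {m n} (R : Fin m → Fin m → Set) (w : Word m (suc (suc n))) →
               LastRepeated (init w) → R (last (init w)) (last w) → Pattern R w
pattern-last {n = n} R w (i , wi≡y) Ryx =
  inject₁ (inject₁ i) , inject₁ (fromℕ n) , fromℕ (suc n) ,
  subst₂ _<_ (sym (trans (FP.toℕ-inject₁ _) (FP.toℕ-inject₁ i))) (sym toℕ-j) (FP.toℕ<n i) ,
  trans (FP.toℕ-fromℕ (suc n)) (cong suc (sym toℕ-j)) , wi≡y , Ryx
  where
  toℕ-j : toℕ (inject₁ (fromℕ n)) ≡ n
  toℕ-j = trans (FP.toℕ-inject₁ (fromℕ n)) (FP.toℕ-fromℕ n)

pattern-snoc : ∀ {m n} (R : Fin m → Fin m → Set) (w : Word m (suc (suc n))) → Pattern R w →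
               Pattern R (init w) ⊎ (LastRepeated (init w) × R (last (init w)) (last w))
pattern-snoc {n = n} R w (i , j , k , i<j , k≡1+j , wi≡wj , Rjk) with toℕ k ℕP.≟ suc n
... | no k≢1+n = inj₁ (i' , j' , k' ,
                       subst₂ _<_ (sym (toℕ-below i′)) (sym (toℕ-below j′)) i<j ,
                       trans (toℕ-below k′) (trans k≡1+j (cong suc (sym (toℕ-below j′)))) ,
                       trans (cong w i≡) (trans wi≡wj (sym (cong w j≡))) ,
                       subst₂ R (sym (cong w j≡)) (sym (cong w k≡)) Rjk)
  where
  k<1+n : toℕ k < suc n
  k<1+n = ℕP.≤∧≢⇒< (s≤s⁻¹ (FP.toℕ<n k)) k≢1+n
  j<1+n : toℕ j < suc n
  j<1+n = ℕP.<-trans (ℕP.≤-reflexive (sym k≡1+j)) k<1+n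
  k′ = inject₁-below k k<1+n
  j′ = inject₁-below j j<1+n
  i′ = inject₁-below i (ℕP.<-trans i<j j<1+n)
  i' = proj₁ i′ ; i≡ = proj₂ i′
  j' = proj₁ j′ ; j≡ = proj₂ j′
  k' = proj₁ k′ ; k≡ = proj₂ k′
... | yes k≡1+n = inj₂ ((i'' , trans (cong w i≡) (trans wi≡wj (cong w j≡n))) ,
                        subst₂ R (cong w j≡n) (cong w k≡1+n') Rjk)
  where
  toℕ-j : toℕ j ≡ n
  toℕ-j = ℕP.suc-injective (trans (sym k≡1+j) k≡1+n)
  j≡n : j ≡ inject₁ (fromℕ n)
  j≡n = FP.toℕ-injective (trans toℕ-j (sym (trans (FP.toℕ-inject₁ (fromℕ n)) (FP.toℕ-fromℕ n))))
  k≡1+n' : k ≡ fromℕ (suc n)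
  k≡1+n' = FP.toℕ-injective (trans k≡1+n (sym (FP.toℕ-fromℕ (suc n))))
  i<n : toℕ i < n
  i<n = subst (toℕ i <_) toℕ-j i<j
  i′ = inject₁-below i (ℕP.m<n⇒m<1+n i<n)
  i″ = inject₁-below (proj₁ i′) (subst (_< n) (sym (toℕ-below i′)) i<n)
  i'' = proj₁ i″
  i≡ : inject₁ (inject₁ i'') ≡ i
  i≡ = trans (cong inject₁ (proj₂ i″)) (proj₂ i′)

-- u can be followed by any letter below j without creating an occurrence of 1-11 or 1-12
-- at the end: u is empty, or its last letter is new, or its last letter is at least j.
Extendable : ∀ {m n} → ℕ → Word m n → Set
Extendable {n = zero}  j u = ⊤
Extendable {n = suc n} j u = ¬ (LastRepeated u × toℕ (last u) < j)

extendable? : ∀ {m n} j → Decidable (Extendable {m} {n} j)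
extendable? {n = zero}  j u = yes tt
extendable? {n = suc n} j u = ¬? (lastRepeated? u ×-dec (toℕ (last u) ℕP.<? j))

avoidsBoth-snoc : ∀ {m n} (w : Word m (suc n)) →
                  AvoidsBoth w ⇔ (AvoidsBoth (init w) × Extendable (suc (toℕ (last w))) (init w))
avoidsBoth-snoc {n = zero} w = mk⇔ (λ _ → ((λ ()) , (λ ())) , tt) (λ _ → too-short _≡_ , too-short F._<_)
  where
  too-short : ∀ R → ¬ Pattern R w
  too-short R (_ , _ , F.zero , _ , () , _)
avoidsBoth-snoc {n = suc n} w = mk⇔
  (λ (no11 , no12) → (no11 ∘ pattern-init _≡_ w , no12 ∘ pattern-init F._<_ w) ,
                     λ (rep , y≤x) → [ no12 ∘ pattern-last F._<_ w rep
                                     , no11 ∘ pattern-last _≡_ w rep ∘ FP.toℕ-injective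
                                     ]′ (ℕP.m≤n⇒m<n∨m≡n (s≤s⁻¹ y≤x)))
  (λ ((no11 , no12) , ext) → avoids _≡_ (ℕP.≤-reflexive ∘ cong toℕ) no11 ext ,
                             avoids F._<_ ℕP.<⇒≤ no12 ext)
  where
  -- an occurrence ending at the last letter x needs a repeated last letter y of init w with y ≤ x
  avoids : (R : Fin _ → Fin _ → Set) → (∀ {a b} → R a b → toℕ a ≤ toℕ b) →
           ¬ Pattern R (init w) → Extendable (suc (toℕ (last w))) (init w) → ¬ Pattern R w
  avoids R R⇒≤ no-init ext p = [ no-init , (λ (rep , Ryx) → ext (rep , s≤s (R⇒≤ Ryx))) ]′ (pattern-snoc R w p)

Occurs : ∀ {m n} → Fin m → Word m n → Set
Occurs a w = ∃ λ i → w i ≡ a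

occurs? : ∀ {m n} (a : Fin m) → Decidable (Occurs {m} {n} a)
occurs? a w = FP.any? (λ i → w i F.≟ a)

Covers : ∀ {m n} → ℕ → Word m n → Set
Covers {m} j w = ∀ (a : Fin m) → toℕ a < j → Occurs a w

covers? : ∀ {m n} j → Decidable (Covers {m} {n} j)
covers? j w = FP.all? (λ a → (toℕ a ℕP.<? j) →-dec occurs? a w)

covers-≗ : ∀ {m n} j → Invariant (Covers {m} {n} j)
covers-≗ j w≗w' cov a a<j = let (i , wi≡a) = cov a a<j in i , trans (sym (w≗w' i)) wi≡a

punchIn-≥ : ∀ {m} (i : Fin (suc m)) (a : Fin m) → toℕ a ≤ toℕ (punchIn i a)
punchIn-≥ F.zero    a         = ℕP.n≤1+n (toℕ a)
punchIn-≥ (F.suc i) F.zero    = z≤n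
punchIn-≥ (F.suc i) (F.suc a) = s≤s (punchIn-≥ i a)

punchIn-< : ∀ {m} (i : Fin (suc m)) (a : Fin m) → toℕ a < toℕ i → toℕ (punchIn i a) ≡ toℕ a
punchIn-< (F.suc i) F.zero    _         = refl
punchIn-< (F.suc i) (F.suc a) (s≤s a<i) = cong suc (punchIn-< i a a<i)

-- Removing a letter j leaves the letters below j in place, so covering them is unaffected.
covers-punchIn : ∀ {m n} (j : Fin (suc m)) (v : Word m n) → Covers (toℕ j) (punchIn j ∘ v) ⇔ Covers (toℕ j) v
covers-punchIn j v = mk⇔ to from
  where
  to : Covers (toℕ j) (punchIn j ∘ v) → Covers (toℕ j) v
  to cov a a<j = occurrence (cov (punchIn j a) (subst (_< toℕ j) (sym (punchIn-< j a a<j)) a<j))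
    where
    occurrence : Occurs (punchIn j a) (punchIn j ∘ v) → Occurs a v
    occurrence (i , e) = i , FP.punchIn-injective j _ _ e
  -- a letter b below j is punchIn j a for a = punchOut b, and a ≤ b
  from : Covers (toℕ j) v → Covers (toℕ j) (punchIn j ∘ v)
  from cov b b<j = occurrence (cov a a<j)
    where
    j≢b = FP.<⇒≢ b<j ∘ sym
    a = F.punchOut j≢b
    a<j : toℕ a < toℕ j
    a<j = ℕP.≤-<-trans (punchIn-≥ j a) (subst (λ c → toℕ c < toℕ j) (sym (FP.punchIn-punchOut j≢b)) b<j)
    occurrence : Occurs a v → Occurs b (punchIn j ∘ v)
    occurrence (i , e) = i , trans (cong (punchIn j) e) (FP.punchIn-punchOut j≢b)

covers-suc : ∀ {m n} (j : Fin m) (w : Word m n) → (Covers (toℕ j) w × Occurs j w) ⇔ Covers (suc (toℕ j)) w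
covers-suc j w = mk⇔
  (λ (cov , occ) a a≤j → [ cov a , (λ a≡j → subst (λ b → Occurs b w) (sym (FP.toℕ-injective a≡j)) occ) ]′
                             (ℕP.m≤n⇒m<n∨m≡n (s≤s⁻¹ a≤j)))
  (λ cov → (λ a a<j → cov a (ℕP.m≤n⇒m≤1+n a<j)) , cov j ℕP.≤-refl)

AvoidsCovering : ∀ {m n} → ℕ → Word m n → Set
AvoidsCovering j w = AvoidsBoth w × Covers j w

avoidsCovering? : ∀ {m n} j → Decidable (AvoidsCovering {m} {n} j)
avoidsCovering? j w = avoidsBoth? w ×-dec covers? j w

U : ℕ → ℕ → ℕ → ℕ
U m j n = #words m n (avoidsCovering? j)

U-step : ∀ m n (j : Fin (suc m)) → U (suc m) (toℕ j) n ≡ U (suc m) (suc (toℕ j)) n + U m (toℕ j) n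
U-step m n j = begin
  U (suc m) (toℕ j) n
    ≡⟨ count-split (avoidsCovering? (toℕ j)) (occurs? j) _ ⟩
  #words (suc m) n (λ w → avoidsCovering? (toℕ j) w ×-dec occurs? j w)
    + #words (suc m) n (λ w → avoidsCovering? (toℕ j) w ×-dec ¬? (occurs? j w))
    ≡⟨ cong₂ _+_ (count-cong _ _ occurring _) (count-cong _ _ omitting _) ⟩
  U (suc m) (suc (toℕ j)) n + #words (suc m) n (λ w → omits? j w ×-dec avoidsCovering? (toℕ j) w)
    ≡⟨ cong (U (suc m) (suc (toℕ j)) n +_) (#words-omitting m n j (avoidsCovering? (toℕ j)) invariant) ⟩
  U (suc m) (suc (toℕ j)) n + #words m n (λ v → avoidsCovering? (toℕ j) (punchIn j ∘ v))
    ≡⟨ cong (U (suc m) (suc (toℕ j)) n +_) (count-cong _ _ relabelled _) ⟩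
  U (suc m) (suc (toℕ j)) n + U m (toℕ j) n
    ∎
  where
  open ≡-Reasoning
  occurring : (λ w → AvoidsCovering (toℕ j) w × Occurs j w) ≐ AvoidsCovering (suc (toℕ j))
  occurring = (λ ((av , cov) , occ) → av , Equivalence.to (covers-suc j _) (cov , occ))
            , (λ (av , cov) → let (cov' , occ) = Equivalence.from (covers-suc j _) cov in (av , cov') , occ)
  omitting : (λ w → AvoidsCovering (toℕ j) w × ¬ Occurs j w) ≐ (λ w → Omits j w × AvoidsCovering (toℕ j) w)
  omitting = (λ (ac , ¬occ) → (λ i e → ¬occ (i , e)) , ac) , (λ (om , ac) → ac , λ (i , e) → om i e)
  invariant : Invariant (AvoidsCovering {suc m} {n} (toℕ j))
  invariant w≗w' (av , cov) = avoidsBoth-≗ w≗w' av , covers-≗ (toℕ j) w≗w' cov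
  relabelled : (λ v → AvoidsCovering (toℕ j) (punchIn j ∘ v)) ≐ AvoidsCovering (toℕ j)
  relabelled = (λ (av , cov) → Equivalence.to (avoidsBoth-punchIn j _) av , Equivalence.to (covers-punchIn j _) cov)
             , (λ (av , cov) → Equivalence.from (avoidsBoth-punchIn j _) av , Equivalence.from (covers-punchIn j _) cov)

binomialSum : ℕ → (ℕ → ℕ) → ℕ
binomialSum m a = ∑[ k < suc m ] ((m C toℕ k) * a (toℕ k))

binomialSum-suc : ∀ m (a : ℕ → ℕ) → binomialSum (suc m) a ≡ binomialSum m a + binomialSum m (a ∘ suc)
binomialSum-suc m a = begin
  binomialSum (suc m) a
    ≡⟨ cong (1 * a 0 +_) (sum-cong-≗ {suc m} pascal) ⟩
  1 * a 0 + ∑[ k < suc m ] ((m C toℕ k) * a (suc (toℕ k)) + (m C suc (toℕ k)) * a (suc (toℕ k)))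
    ≡⟨ cong (1 * a 0 +_) (∑-distrib-+ {suc m} (λ k → (m C toℕ k) * a (suc (toℕ k))) (λ k → f (toℕ k))) ⟩
  1 * a 0 + (binomialSum m (a ∘ suc) + ∑[ k < suc m ] f (toℕ k))
    ≡⟨ cong (λ t → 1 * a 0 + (binomialSum m (a ∘ suc) + t)) (sum-last f m) ⟩
  1 * a 0 + (binomialSum m (a ∘ suc) + (∑[ k < m ] f (toℕ k) + f m))
    ≡⟨ cong (λ t → 1 * a 0 + (binomialSum m (a ∘ suc) + (∑[ k < m ] f (toℕ k) + t * a (suc m))))
            (k>n⇒nCk≡0 (ℕP.n<1+n m)) ⟩
  1 * a 0 + (binomialSum m (a ∘ suc) + (∑[ k < m ] f (toℕ k) + 0))
    ≡⟨ cong (λ t → 1 * a 0 + (binomialSum m (a ∘ suc) + t)) (ℕP.+-identityʳ _) ⟩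
  1 * a 0 + (binomialSum m (a ∘ suc) + ∑[ k < m ] f (toℕ k))
    ≡⟨ cong (1 * a 0 +_) (ℕP.+-comm (binomialSum m (a ∘ suc)) _) ⟩
  1 * a 0 + (∑[ k < m ] f (toℕ k) + binomialSum m (a ∘ suc))
    ≡⟨ ℕP.+-assoc (1 * a 0) _ _ ⟨
  binomialSum m a + binomialSum m (a ∘ suc)
    ∎
  where
  open ≡-Reasoning
  f : ℕ → ℕ
  f k = (m C suc k) * a (suc k)
  pascal : ∀ (k : Fin (suc m)) → (suc m C suc (toℕ k)) * a (suc (toℕ k)) ≡ (m C toℕ k) * a (suc (toℕ k)) + f (toℕ k)
  pascal k = trans (cong (_* a (suc (toℕ k))) (sym (nCk+nC[k+1]≡[n+1]C[k+1] m (toℕ k))))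
                   (ℕP.*-distribʳ-+ (a (suc (toℕ k))) (m C toℕ k) _)

Onto : ℕ → ℕ → ℕ
Onto t n = U t t n

-- Binomial transform: U(j+m, j) = ∑_k C(m,k) Onto(j+k), by induction on the number m of
-- letters that need not occur, using U-step to dispose of the letter j.
U-binomial : ∀ m j n → U (j + m) j n ≡ binomialSum m (λ k → Onto (j + k) n)
U-binomial zero j n rewrite ℕP.+-identityʳ j = sym (trans (ℕP.+-identityʳ _) (ℕP.*-identityˡ _))
U-binomial (suc m) j n = begin
  U (j + suc m) j n
    ≡⟨ cong (λ t → U t j n) (ℕP.+-suc j m) ⟩
  U (suc (j + m)) j n
    ≡⟨ subst (λ t → U (suc (j + m)) t n ≡ U (suc (j + m)) (suc t) n + U (j + m) t n)
             (FP.toℕ-fromℕ< j<1+j+m) (U-step (j + m) n (F.fromℕ< j<1+j+m)) ⟩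
  U (suc j + m) (suc j) n + U (j + m) j n
    ≡⟨ cong₂ _+_ (U-binomial m (suc j) n) (U-binomial m j n) ⟩
  binomialSum m (λ k → Onto (suc j + k) n) + binomialSum m (λ k → Onto (j + k) n)
    ≡⟨ ℕP.+-comm (binomialSum m (λ k → Onto (suc j + k) n)) _ ⟩
  binomialSum m (λ k → Onto (j + k) n) + binomialSum m (λ k → Onto (suc j + k) n)
    ≡⟨ cong (binomialSum m (λ k → Onto (j + k) n) +_)
            (sum-cong-≗ {suc m} (λ k → cong (λ t → (m C toℕ k) * Onto t n) (sym (ℕP.+-suc j (toℕ k))))) ⟩
  binomialSum m (λ k → Onto (j + k) n) + binomialSum m (λ k → Onto (j + suc k) n)
    ≡⟨ binomialSum-suc m (λ k → Onto (j + k) n) ⟨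
  binomialSum (suc m) (λ k → Onto (j + k) n)
    ∎
  where
  open ≡-Reasoning
  j<1+j+m : j < suc (j + m)
  j<1+j+m = s≤s (ℕP.m≤m+n j m)

extendable-≗ : ∀ {m n} j → Invariant (Extendable {m} {n} j)
extendable-≗ {n = zero}  j w≗w' _   = tt
extendable-≗ {n = suc n} j w≗w' ext ((i , e) , y<j) =
  ext ((i , trans (w≗w' (inject₁ i)) (trans e (sym (w≗w' (fromℕ n))))) ,
       subst (λ y → toℕ y < j) (sym (w≗w' (fromℕ n))) y<j)

extendable-suc : ∀ {m n} j (w : Word m n) → Extendable (suc j) w → Extendable j w
extendable-suc {n = zero}  j w _   = tt
extendable-suc {n = suc n} j w ext (rep , y<j) = ext (rep , ℕP.m≤n⇒m≤1+n y<j)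

occurs-init : ∀ {m n} {a : Fin m} (w : Word m (suc n)) → LastRepeated w → Occurs a w → Occurs a (init w)
occurs-init w (i' , e') (i , wi≡a) =
  [ (λ (i₀ , i₀≡i) → i₀ , trans (cong w i₀≡i) wi≡a)
  , (λ i≡n → i' , trans e' (trans (cong w (sym i≡n)) wi≡a))
  ]′ (position-view i)

lastLetterUnique⇔ : ∀ {m n} (w : Word m (suc n)) → LastLetterUnique w ⇔ (¬ LastRepeated w)
lastLetterUnique⇔ {n = n} w = mk⇔
  (λ (l , 1+l≡1+n , unique) (i , e) →
     let l≡n = FP.toℕ-injective (trans (ℕP.suc-injective 1+l≡1+n) (sym (FP.toℕ-fromℕ n)))
     in unique (inject₁ i) (λ i≡l → FP.fromℕ≢inject₁ (sym (trans i≡l l≡n))) (trans e (cong w (sym l≡n))))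
  (λ ¬rep → fromℕ n , cong suc (FP.toℕ-fromℕ n) , λ i i≢n e →
     [ (λ (i₀ , i₀≡i) → ¬rep (i₀ , trans (cong w i₀≡i) e)) , i≢n ]′ (position-view i))

Good : ∀ {m n} → ℕ → Word m n → Set
Good j w = AllLettersOccur w × AvoidsBoth w × Extendable j w

good? : ∀ {m n} j → Decidable (Good {m} {n} j)
good? j w = allLettersOccur? w ×-dec (avoidsBoth? w ×-dec extendable? j w)

good-≗ : ∀ {m n} j → Invariant (Good {m} {n} j)
good-≗ j w≗w' (all , av , ext) =
  (λ a → let (i , e) = all a in i , trans (sym (w≗w' i)) e) , avoidsBoth-≗ w≗w' av , extendable-≗ j w≗w' ext

V : ℕ → ℕ → ℕ → ℕ
V k j n = #words k n (good? j)

good-not-suc⇔ : ∀ {k n} (j : Fin k) (w : Word k (suc n)) →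
                (Good (toℕ j) w × ¬ Extendable (suc (toℕ j)) w) ⇔ (last w ≡ j × Good (suc (toℕ j)) (init w))
good-not-suc⇔ j w = mk⇔ to from
  where
  to : Good (toℕ j) w × ¬ Extendable (suc (toℕ j)) w → last w ≡ j × Good (suc (toℕ j)) (init w)
  to ((all , av , ext) , ¬ext') =
    last≡j , (λ a → occurs-init w rep (all a)) , subst (λ y → AvoidsBoth (init w) × Extendable (suc y) (init w))
                                                          (cong toℕ last≡j) (Equivalence.to (avoidsBoth-snoc w) av)
    where
    rep-≤ : LastRepeated w × toℕ (last w) < suc (toℕ j)
    rep-≤ = decidable-stable (lastRepeated? w ×-dec (toℕ (last w) ℕP.<? suc (toℕ j))) ¬ext'
    rep = proj₁ rep-≤
    last≡j : last w ≡ j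
    last≡j = FP.toℕ-injective (ℕP.≤-antisym (s≤s⁻¹ (proj₂ rep-≤)) (ℕP.≮⇒≥ (λ y<j → ext (rep , y<j))))
  from : last w ≡ j × Good (suc (toℕ j)) (init w) → Good (toℕ j) w × ¬ Extendable (suc (toℕ j)) w
  from (last≡j , all , av , ext) =
    ((λ a → let (i , e) = all a in inject₁ i , e) ,
     Equivalence.from (avoidsBoth-snoc w) (av , subst (λ y → Extendable (suc y) (init w)) (sym (cong toℕ last≡j)) ext) ,
     (λ (_ , y<j) → ℕP.<-irrefl (cong toℕ last≡j) y<j)) ,
    (λ ext' → ext' (j-repeated , s≤s (ℕP.≤-reflexive (cong toℕ last≡j))))
    where
    -- the letter j occurs in init w, so the final j is a repetition
    j-repeated : LastRepeated w
    j-repeated = let (i , e) = all j in i , trans e (sym last≡j)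

-- Every word is extendable, so the empty word does not distinguish j from j+1.
V-step-zero : ∀ k j → V k j 0 ≡ V k (suc j) 0
V-step-zero k j = count-cong (good? j) (good? (suc j)) ((λ g → g) , (λ g → g)) (allWords k 0)

V-step : ∀ k n (j : Fin k) → V k (toℕ j) (suc n) ≡ V k (suc (toℕ j)) (suc n) + V k (suc (toℕ j)) n
V-step k n j = begin
  V k (toℕ j) (suc n)
    ≡⟨ count-split (good? (toℕ j)) (extendable? (suc (toℕ j))) _ ⟩
  #words k (suc n) (λ w → good? (toℕ j) w ×-dec extendable? (suc (toℕ j)) w)
    + #words k (suc n) (λ w → good? (toℕ j) w ×-dec ¬? (extendable? (suc (toℕ j)) w))
    ≡⟨ cong₂ _+_ (count-cong _ _ still-good _) (count-cong _ _ ends-in-j _) ⟩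
  V k (suc (toℕ j)) (suc n) + #words k (suc n) (λ w → (last w F.≟ j) ×-dec good? (suc (toℕ j)) (init w))
    ≡⟨ cong (V k (suc (toℕ j)) (suc n) +_) (#words-snoc k n (good? (suc (toℕ j))) (good-≗ (suc (toℕ j))) j) ⟩
  V k (suc (toℕ j)) (suc n) + V k (suc (toℕ j)) n
    ∎
  where
  open ≡-Reasoning
  still-good : (λ w → Good (toℕ j) w × Extendable (suc (toℕ j)) w) ≐ Good {k} {suc n} (suc (toℕ j))
  still-good = (λ ((all , av , _) , ext) → all , av , ext)
             , (λ {w} (all , av , ext) → (all , av , extendable-suc (toℕ j) w ext) , ext)
  ends-in-j : (λ w → Good (toℕ j) w × ¬ Extendable (suc (toℕ j)) w)
            ≐ (λ w → last w ≡ j × Good (suc (toℕ j)) (init w))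
  ends-in-j = (λ {w} → Equivalence.to (good-not-suc⇔ j w)) , (λ {w} → Equivalence.from (good-not-suc⇔ j w))

-- With j = 0 nothing is required of the last letter: V(k, 0) = Onto(k).
Onto≡V-zero : ∀ k n → Onto k n ≡ V k 0 n
Onto≡V-zero k n = count-cong (avoidsCovering? k) (good? 0)
  ((λ {w} (av , cov) → (λ a → cov a (FP.toℕ<n a)) , av , extendable-zero w) , (λ (all , av , _) → av , λ a _ → all a))
  (allWords k n)
  where
  extendable-zero : ∀ {n} (w : Word k n) → Extendable 0 w
  extendable-zero {zero}  w = tt
  extendable-zero {suc n} w (_ , ())

-- With j = k every last letter lies below j, so V(k, k) counts the words with a new last letter.
V-top : ∀ k n → V (suc k) (suc k) n ≡ c n (suc k)
V-top k n = trans (count-cong (good? (suc k)) countedByC? (good⇔counted n) (allWords (suc k) n))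
                  (count-filter countedByC? (allWords (suc k) n))
  where
  good⇔counted : ∀ n → Good {suc k} {n} (suc k) ≐ CountedByC
  good⇔counted zero    = (λ (all , _) → ⊥-elim (no-position (proj₁ (all F.zero))))
                       , (λ (_ , _ , l , _) → ⊥-elim (no-position l))
    where no-position : Fin 0 → ⊥
          no-position ()
  good⇔counted (suc n) =
    (λ {w} (all , av , ext) → all , av , Equivalence.from (lastLetterUnique⇔ w) (λ rep → ext (rep , FP.toℕ<n (last w)))) ,
    (λ {w} (all , av , unique) → all , av , λ (rep , _) → Equivalence.to (lastLetterUnique⇔ w) unique rep)

x·_ : Series → Series
(x· f) zero    = 0
(x· f) (suc n) = f n

x·-cong : ∀ {f g} → (∀ n → f n ≡ g n) → ∀ n → (x· f) n ≡ (x· g) n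
x·-cong f≡g zero    = refl
x·-cong f≡g (suc n) = f≡g n

⊛-as-∑ : ∀ f g n → (f ⊛ g) n ≡ ∑[ i < suc n ] (f (toℕ i) * g (n ∸ toℕ i))
⊛-as-∑ f g n = sum-upTo (λ i → f i * g (n ∸ i)) (suc n)

⊛-identityˡ : ∀ f n → (oneS ⊛ f) n ≡ f n
⊛-identityˡ f n = begin
  (oneS ⊛ f) n                         ≡⟨ ⊛-as-∑ oneS f n ⟩
  1 * f n + ∑[ i < n ] (0 * f (n ∸ suc (toℕ i)))  ≡⟨ cong (1 * f n +_) (sum-zero {n} _ (λ _ → refl)) ⟩
  1 * f n + 0                          ≡⟨ ℕP.+-identityʳ _ ⟩
  1 * f n                              ≡⟨ ℕP.*-identityˡ _ ⟩
  f n                                  ∎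
  where open ≡-Reasoning

⊛-distribʳ : ∀ f f₁ f₂ g → (∀ i → f i ≡ f₁ i + f₂ i) → ∀ n → (f ⊛ g) n ≡ (f₁ ⊛ g) n + (f₂ ⊛ g) n
⊛-distribʳ f f₁ f₂ g f≡ n = begin
  (f ⊛ g) n
    ≡⟨ ⊛-as-∑ f g n ⟩
  ∑[ i < suc n ] (f (toℕ i) * g (n ∸ toℕ i))
    ≡⟨ sum-cong-≗ {suc n} (λ i → trans (cong (_* g (n ∸ toℕ i)) (f≡ (toℕ i)))
                                       (ℕP.*-distribʳ-+ _ (f₁ (toℕ i)) _)) ⟩
  ∑[ i < suc n ] (f₁ (toℕ i) * g (n ∸ toℕ i) + f₂ (toℕ i) * g (n ∸ toℕ i))
    ≡⟨ ∑-distrib-+ {suc n} (λ i → f₁ (toℕ i) * g (n ∸ toℕ i)) (λ i → f₂ (toℕ i) * g (n ∸ toℕ i)) ⟩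
  ∑[ i < suc n ] (f₁ (toℕ i) * g (n ∸ toℕ i)) + ∑[ i < suc n ] (f₂ (toℕ i) * g (n ∸ toℕ i))
    ≡⟨ cong₂ _+_ (⊛-as-∑ f₁ g n) (⊛-as-∑ f₂ g n) ⟨
  (f₁ ⊛ g) n + (f₂ ⊛ g) n
    ∎
  where open ≡-Reasoning

x·-⊛ : ∀ f g n → ((x· f) ⊛ g) n ≡ (x· (f ⊛ g)) n
x·-⊛ f g zero    = refl
x·-⊛ f g (suc n) = trans (⊛-as-∑ (x· f) g (suc n)) (sym (⊛-as-∑ f g n))

onePlusX-⊛ : ∀ f n → (onePlusX ⊛ f) n ≡ f n + (x· f) n
onePlusX-⊛ f zero    = trans (ℕP.+-identityʳ (1 * f 0)) (trans (ℕP.*-identityˡ (f 0)) (sym (ℕP.+-identityʳ (f 0))))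
onePlusX-⊛ f (suc n) = begin
  (onePlusX ⊛ f) (suc n)
    ≡⟨ ⊛-as-∑ onePlusX f (suc n) ⟩
  1 * f (suc n) + (1 * f n + ∑[ i < n ] (0 * f (n ∸ suc (toℕ i))))
    ≡⟨ cong (λ t → 1 * f (suc n) + (1 * f n + t)) (sum-zero {n} _ (λ _ → refl)) ⟩
  1 * f (suc n) + (1 * f n + 0)
    ≡⟨ cong₂ _+_ (ℕP.*-identityˡ (f (suc n))) (trans (ℕP.+-identityʳ (1 * f n)) (ℕP.*-identityˡ (f n))) ⟩
  f (suc n) + f n
    ∎
  where open ≡-Reasoning

onePlusX-⊛-⊛ : ∀ f g n → ((onePlusX ⊛ f) ⊛ g) n ≡ (f ⊛ g) n + (x· (f ⊛ g)) n
onePlusX-⊛-⊛ f g n = trans (⊛-distribʳ (onePlusX ⊛ f) f (x· f) g (onePlusX-⊛ f) n)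
                           (cong ((f ⊛ g) n +_) (x·-⊛ f g n))

V-rec : ∀ k j → j < k → ∀ n → V k j n ≡ V k (suc j) n + (x· V k (suc j)) n
V-rec k j j<k zero    = trans (V-step-zero k j) (sym (ℕP.+-identityʳ _))
V-rec k j j<k (suc n) = subst (λ t → V k t (suc n) ≡ V k (suc t) (suc n) + V k (suc t) n)
                              (FP.toℕ-fromℕ< j<k) (V-step k n (F.fromℕ< j<k))

V-closed : ∀ k d j → j + d ≡ suc k → ∀ n → V (suc k) j n ≡ ((onePlusX ^ˢ d) ⊛ Cser (suc k)) n
V-closed k zero j j+0≡1+k n rewrite ℕP.+-identityʳ j | j+0≡1+k =
  trans (V-top k n) (sym (⊛-identityˡ (Cser (suc k)) n))
V-closed k (suc d) j j+1+d≡1+k n = begin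
  V (suc k) j n
    ≡⟨ V-rec (suc k) j j<1+k n ⟩
  V (suc k) (suc j) n + (x· V (suc k) (suc j)) n
    ≡⟨ cong₂ _+_ (IH n) (x·-cong IH n) ⟩
  ((onePlusX ^ˢ d) ⊛ Cser (suc k)) n + (x· ((onePlusX ^ˢ d) ⊛ Cser (suc k))) n
    ≡⟨ onePlusX-⊛-⊛ (onePlusX ^ˢ d) (Cser (suc k)) n ⟨
  ((onePlusX ^ˢ suc d) ⊛ Cser (suc k)) n
    ∎
  where
  open ≡-Reasoning
  IH : ∀ n → V (suc k) (suc j) n ≡ ((onePlusX ^ˢ d) ⊛ Cser (suc k)) n
  IH = V-closed k d (suc j) (trans (sym (ℕP.+-suc j d)) j+1+d≡1+k)
  j<1+k : j < suc k
  j<1+k = subst (j <_) j+1+d≡1+k (ℕP.m<m+n j (s≤s z≤n))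

-- Onto(k) = (1 + x)^k C_k; over the empty alphabet only the empty word exists, matching C_0 = 1.
Onto-series : ∀ k n → Onto k n ≡ ((onePlusX ^ˢ k) ⊛ Cser k) n
Onto-series zero    zero    = count-filter (avoidsCovering? 0) (allWords 0 0)
Onto-series zero    (suc n) = trans (#words-cons 0 n (avoidsCovering? 0)) (sym (⊛-identityˡ oneS (suc n)))
Onto-series (suc k) n       = trans (Onto≡V-zero (suc k) n) (V-closed k (suc k) 0 refl n)

-- W_m = U(m, 0) = ∑_k C(m,k) Onto(k) = ∑_k C(m,k) (1 + x)^k C_k.
mainTheorem12 : (m : ℕ) → 1 ≤ m → (n : ℕ) → Wser m n ≡ RHS m n
mainTheorem12 m _ n = begin
  Wser m n
    ≡⟨ count-filter avoidsBoth? (allWords m n) ⟨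
  count avoidsBoth? (allWords m n)
    ≡⟨ count-cong avoidsBoth? (avoidsCovering? 0) ((λ av → av , λ _ ()) , proj₁) (allWords m n) ⟩
  U m 0 n
    ≡⟨ U-binomial m 0 n ⟩
  binomialSum m (λ k → Onto k n)
    ≡⟨ sum-cong-≗ {suc m} (λ k → cong ((m C toℕ k) *_) (Onto-series (toℕ k) n)) ⟩
  binomialSum m (λ k → ((onePlusX ^ˢ k) ⊛ Cser k) n)
    ≡⟨ sum-upTo (λ k → (m C k) * ((onePlusX ^ˢ k) ⊛ Cser k) n) (suc m) ⟨
  RHS m n
    ∎
  where open ≡-Reasoning
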